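{- Let $G$ be a $(P_5,\textit{HVN})$-free graph containing no induced $T$-5-wheel and no induced $Y$-5-wheel, and let $C=v_1v_2v_3v_4v_5v_1$ be an induced 5-cycle of $G$ (indices modulo 5). With $N_C(u)$ the set of neighbours of $u$ in $V(C)$, define $S=\{u: N_C(u)=\emptyset\}$, and for $i\in\{1,\dots,5\}$, $R_i=\{u: N_C(u)=\{v_{i-1},v_{i+1}\}\}$, $P^i=\{u: N_C(u)=\{v_{i-1},v_i,v_{i+1},v_{i+2}\}\}$, and $T=\{u: N_C(u)=V(C)\}$. Then $V(G)=T\cup S\cup\bigcup_{1\le i\le 5}(R_i\cup P^i)$. Moreover, $T\cup\bigcup_{1\le i\le5}P^i$ is stable and each $R_i$ ($1\le i\le 5$) is stable.
   Context: Graphs are finite, simple and connected. $P_5$ is the path on 5 vertices; an HVN is a $K_4$ plus a vertex adjacent to exactly two vertices of the $K_4$; $(H_1,H_2)$-free means no induced $H_1$ or $H_2$. A $T$-5-wheel is a chordless 5-cycle $w_1w_2w_3w_4w_5w_1$ plus a vertex adjacent to exactly three consecutive vertices of it (e.g. $w_5,w_1,w_2$). A $Y$-5-wheel is a chordless 5-cycle $w_1w_2w_3w_4w_5w_1$ plus a vertex adjacent to exactly $w_1,w_2,w_4$. A set is stable if it induces no edges. -}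

module Defs where

open import Data.Nat using (ℕ; zero; suc; _≡ᵇ_)
open import Data.Fin using (Fin; toℕ) renaming (zero to f0; suc to fs)
open import Data.Fin.Properties using (_≟_)
open import Data.Bool using (Bool; true; false; _∨_; _∧_)
open import Data.List using (List; []; _∷_)
open import Data.Bool.ListAction using (any)
open import Data.Product using (Σ; _×_; _,_; ∃)
open import Data.Sum using (_⊎_)
open import Data.Empty using (⊥)
open import Relation.Nullary using (¬_)
open import Relation.Nullary.Decidable using (isYes)
open import Relation.Binary.PropositionalEquality using (_≡_)
open import Function.Definitions using (Injective)

record Graph (n : ℕ) : Set where
  field
    adj   : Fin n → Fin n → Bool
    sym   : ∀ x y → adj x y ≡ adj y x
    irrefl : ∀ x → adj x x ≡ false

open Graph public

data Walk {n : ℕ} (G : Graph n) : Fin n → Fin n → Set where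
  here : ∀ {x} → Walk G x x
  step : ∀ {x y z} → adj G x y ≡ true → Walk G y z → Walk G x z

Connected : ∀ {n} → Graph n → Set
Connected {n} G = ∀ (x y : Fin n) → Walk G x y

edgesAdj : ∀ {k} → List (ℕ × ℕ) → Fin k → Fin k → Bool
edgesAdj es i j = any (λ { (a , b) → ((toℕ i ≡ᵇ a) ∧ (toℕ j ≡ᵇ b)) ∨ ((toℕ i ≡ᵇ b) ∧ (toℕ j ≡ᵇ a)) }) es

HasInduced : ∀ {n k} → Graph n → (Fin k → Fin k → Bool) → Set
HasInduced {n} {k} G H =
  Σ (Fin k → Fin n) λ f → Injective _≡_ _≡_ f × (∀ i j → adj G (f i) (f j) ≡ H i j)

P5 : Fin 5 → Fin 5 → Bool
P5 = edgesAdj ((0 , 1) ∷ (1 , 2) ∷ (2 , 3) ∷ (3 , 4) ∷ [])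

-- HVN: K4 on {0,1,2,3} plus vertex 4 adjacent to exactly 0 and 1
HVN : Fin 5 → Fin 5 → Bool
HVN = edgesAdj ((0 , 1) ∷ (0 , 2) ∷ (0 , 3) ∷ (1 , 2) ∷ (1 , 3) ∷ (2 , 3) ∷ (4 , 0) ∷ (4 , 1) ∷ [])

-- C5: cycle 0-1-2-3-4-0 (vertex i stands for v_{i+1})
C5 : Fin 5 → Fin 5 → Bool
C5 = edgesAdj ((0 , 1) ∷ (1 , 2) ∷ (2 , 3) ∷ (3 , 4) ∷ (4 , 0) ∷ [])

-- T-5-wheel: cycle w1..w5 = 0..4, vertex 5 adjacent to exactly w5,w1,w2 = 4,0,1
TWheel : Fin 6 → Fin 6 → Bool
TWheel = edgesAdj ((0 , 1) ∷ (1 , 2) ∷ (2 , 3) ∷ (3 , 4) ∷ (4 , 0) ∷ (5 , 4) ∷ (5 , 0) ∷ (5 , 1) ∷ [])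

-- Y-5-wheel: cycle w1..w5 = 0..4, vertex 5 adjacent to exactly w1,w2,w4 = 0,1,3
YWheel : Fin 6 → Fin 6 → Bool
YWheel = edgesAdj ((0 , 1) ∷ (1 , 2) ∷ (2 , 3) ∷ (3 , 4) ∷ (4 , 0) ∷ (5 , 0) ∷ (5 , 1) ∷ (5 , 3) ∷ [])

next : Fin 5 → Fin 5
next f0 = fs f0
next (fs f0) = fs (fs f0)
next (fs (fs f0)) = fs (fs (fs f0))
next (fs (fs (fs f0))) = fs (fs (fs (fs f0)))
next (fs (fs (fs (fs f0)))) = f0

prev : Fin 5 → Fin 5
prev f0 = fs (fs (fs (fs f0)))
prev (fs f0) = f0
prev (fs (fs f0)) = fs f0
prev (fs (fs (fs f0))) = fs (fs f0)
prev (fs (fs (fs (fs f0)))) = fs (fs (fs f0))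

_==_ : Fin 5 → Fin 5 → Bool
i == j = isYes (i ≟ j)

-- Sets of vertices defined via N_C(u), where the induced 5-cycle is C = v (v i = v_{i+1}).
module _ {n : ℕ} (G : Graph n) (v : Fin 5 → Fin n) where

  NCis : (Fin 5 → Bool) → Fin n → Set
  NCis pat u = ∀ j → adj G u (v j) ≡ pat j

  Sset : Fin n → Set
  Sset = NCis (λ _ → false)

  Tset : Fin n → Set
  Tset = NCis (λ _ → true)

  Rset : Fin 5 → Fin n → Set
  Rset i = NCis (λ j → (j == prev i) ∨ (j == next i))

  Pset : Fin 5 → Fin n → Set
  Pset i = NCis (λ j → (j == prev i) ∨ (j == i) ∨ (j == next i) ∨ (j == next (next i)))

  TPset : Fin n → Set
  TPset u = Tset u ⊎ ∃ λ i → Pset i u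

Stable : ∀ {n} → Graph n → (Fin n → Set) → Set
Stable {n} G X = ∀ (x y : Fin n) → X x → X y → adj G x y ≡ false

module Submission where

-- Whether a vertex u lies in S, T, some R_i or some P^i depends only on N_C(u), and
-- u together with C spans a 6-vertex graph determined by N_C(u); likewise an edge xy
-- together with C spans a 7-vertex graph determined by N_C(x) and N_C(y). So the lemma
-- reduces to finitely many small graphs: every other neighbourhood on C yields an
-- induced P5, T-5-wheel or Y-5-wheel, an edge inside T ∪ ⋃ P^i an HVN, and an edge
-- inside some R_i a T-5-wheel; these are found by search. They lift to G because the
-- forbidden graphs have no twins, so the composite map into G is injective even when
-- the extra vertices lie on C.

open import Defs hiding (sym)
open import Data.Nat using (ℕ; zero; suc)
open import Data.Fin using (Fin; zero; suc) renaming (_≟_ to _≟ᶠ_)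
open import Data.Fin.Properties using (all?; any?)
open import Data.Bool using (Bool; true; false; _∧_; _∨_; if_then_else_)
open import Data.Bool.Properties using () renaming (_≟_ to _≟ᵇ_)
open import Data.List using (foldr; allFin)
open import Data.Maybe using (Maybe; just; nothing; map; zipWith; _<∣>_; _>>=_; from-just)
open import Data.Vec using (Vec; []; _∷_; lookup; tabulate)
open import Data.Vec.Properties using (lookup∘tabulate)
open import Data.Vec.Functional using () renaming (_∷_ to _◂_)
open import Data.Product using (Σ; ∃; _×_; _,_; proj₁)
open import Data.Sum using (_⊎_; inj₁; inj₂; [_,_]′)
open import Data.Empty using (⊥-elim)
open import Function using (_∘_)
open import Function.Definitions using (Injective)
open import Relation.Nullary using (¬_; Dec; does; ¬?)
open import Relation.Nullary.Decidable using (_⊎-dec_; from-yes; dec⇒maybe)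
open import Relation.Binary.PropositionalEquality
  using (_≡_; _≢_; refl; sym; trans; cong; _≗_)

Adjacency : ℕ → Set
Adjacency k = Fin k → Fin k → Bool

IsFullHom : ∀ {k m} → Adjacency k → Adjacency m → (Fin k → Fin m) → Set
IsFullHom H A g = ∀ i j → A (g i) (g j) ≡ H i j

FullHom : ∀ {k m} → Adjacency k → Adjacency m → Set
FullHom H A = Σ _ (IsFullHom H A)

isFullHom-∘ : ∀ {k l m} {H : Adjacency k} {A : Adjacency l} {B : Adjacency m} {g f} →
              IsFullHom H A g → IsFullHom A B f → IsFullHom H B (f ∘ g)
isFullHom-∘ hg hf i j = trans (hf _ _) (hg i j)

isFullHom? : ∀ {k m} (H : Adjacency k) (A : Adjacency m) g → Dec (IsFullHom H A g)
isFullHom? H A g = all? λ i → all? λ j → A (g i) (g j) ≟ᵇ H i j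

TwinFree : ∀ {k} → Adjacency k → Set
TwinFree H = ∀ i j → i ≡ j ⊎ H i j ≡ true ⊎ ∃ λ l → H i l ≢ H j l

twinFree? : ∀ {k} (H : Adjacency k) → Dec (TwinFree H)
twinFree? H = all? λ i → all? λ j →
  (i ≟ᶠ j) ⊎-dec (H i j ≟ᵇ true) ⊎-dec any? λ l → ¬? (H i l ≟ᵇ H j l)

module _ {n} (G : Graph n) where

  twinFree⇒injective : ∀ {k} {H : Adjacency k} {f} →
                       TwinFree H → IsFullHom H (adj G) f → Injective _≡_ _≡_ f
  twinFree⇒injective {f = f} twinFree hf {i} {j} fi≡fj with twinFree i j
  ... | inj₁ i≡j = i≡j
  ... | inj₂ (inj₁ Hij) with () ←
    trans (sym Hij) (trans (sym (hf i j)) (trans (cong (adj G (f i)) (sym fi≡fj)) (irrefl G (f i))))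
  ... | inj₂ (inj₂ (l , Hil≢Hjl)) =
    ⊥-elim (Hil≢Hjl (trans (sym (hf i l)) (trans (cong (λ z → adj G z (f l)) fi≡fj) (hf j l))))

  hasInduced : ∀ {k m} {H : Adjacency k} {A : Adjacency m} {f} →
               TwinFree H → IsFullHom A (adj G) f → FullHom H A → HasInduced G H
  hasInduced {A = A} {f} twinFree hf (g , hg) =
    f ∘ g , twinFree⇒injective twinFree hfg , hfg
    where
    hfg : IsFullHom _ (adj G) (f ∘ g)
    hfg = isFullHom-∘ {A = A} {B = adj G} {g} {f} hg hf

addVertex : ∀ {m} → (Fin m → Bool) → Adjacency m → Adjacency (suc m)
addVertex b A zero    zero    = false
addVertex b A zero    (suc j) = b j
addVertex b A (suc i) zero    = b i
addVertex b A (suc i) (suc j) = A i j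

isFullHom-addVertex : ∀ {n m} (G : Graph n) {A : Adjacency m} {f b u} →
                      IsFullHom A (adj G) f → adj G u ∘ f ≗ b →
                      IsFullHom (addVertex b A) (adj G) (u ◂ f)
isFullHom-addVertex G hf hb zero    zero    = irrefl G _
isFullHom-addVertex G hf hb zero    (suc j) = hb j
isFullHom-addVertex G hf hb (suc i) zero    = trans (Graph.sym G _ _) (hb i)
isFullHom-addVertex G hf hb (suc i) (suc j) = hf i j

-- Backtracking that tests only A c d against H 0 (suc j), so findFullHom verifies the result.
fullHomCandidate : ∀ {k m} → Adjacency k → Adjacency m → (Fin k → Fin m → Bool) →
                   Maybe (Fin k → Fin m)
fullHomCandidate {zero}      H A allowed = just λ ()
fullHomCandidate {suc k} {m} H A allowed = foldr try nothing (allFin m)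
  where
  try : Fin m → Maybe (Fin (suc k) → Fin m) → Maybe (Fin (suc k) → Fin m)
  try c rest = (if allowed zero c
    then map (c ◂_) (fullHomCandidate (λ i j → H (suc i) (suc j)) A
           λ j d → allowed (suc j) d ∧ does (A c d ≟ᵇ H zero (suc j)))
    else nothing) <∣> rest

findFullHom : ∀ {k m} (H : Adjacency k) (A : Adjacency m) → Maybe (FullHom H A)
findFullHom H A =
  fullHomCandidate H A (λ _ _ → true) >>= λ g → map (g ,_) (dec⇒maybe (isFullHom? H A g))

allFinᵐ : ∀ {k} {P : Fin k → Set} → (∀ i → Maybe (P i)) → Maybe (∀ i → P i)
allFinᵐ {zero}  p = just λ ()
allFinᵐ {suc k} p = zipWith (λ p0 ps → λ { zero → p0 ; (suc i) → ps i }) (p zero) (allFinᵐ (p ∘ suc))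

allMaybeᵐ : ∀ {k} {P : Maybe (Fin k) → Set} → (∀ s → Maybe (P s)) → Maybe (∀ s → P s)
allMaybeᵐ p = zipWith (λ pn pj → λ { nothing → pn ; (just i) → pj i }) (p nothing) (allFinᵐ (p ∘ just))

allBoolVecᵐ : ∀ {k} {P : Vec Bool k → Set} → (∀ w → Maybe (P w)) → Maybe (∀ w → P w)
allBoolVecᵐ {zero}  p = map (λ p[] → λ { [] → p[] }) (p [])
allBoolVecᵐ {suc k} p = zipWith (λ pt pf → λ { (true ∷ w) → pt w ; (false ∷ w) → pf w })
  (allBoolVecᵐ (p ∘ (true ∷_))) (allBoolVecᵐ (p ∘ (false ∷_)))

R-pattern : Fin 5 → Fin 5 → Bool
R-pattern i j = (j == prev i) ∨ (j == next i)

P-pattern : Fin 5 → Fin 5 → Bool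
P-pattern i j = (j == prev i) ∨ (j == i) ∨ (j == next i) ∨ (j == next (next i))

TP-pattern : Maybe (Fin 5) → Fin 5 → Bool
TP-pattern nothing  = λ _ → true
TP-pattern (just i) = P-pattern i

AllowedNeighbourhood : (Fin 5 → Bool) → Set
AllowedNeighbourhood b =
  b ≗ (λ _ → true) ⊎ b ≗ (λ _ → false) ⊎ ∃ λ i → b ≗ R-pattern i ⊎ b ≗ P-pattern i

allowedNeighbourhood? : ∀ b → Dec (AllowedNeighbourhood b)
allowedNeighbourhood? b = agrees (λ _ → true) ⊎-dec agrees (λ _ → false) ⊎-dec
                          any? λ i → agrees (R-pattern i) ⊎-dec agrees (P-pattern i)
  where
  agrees : ∀ c → Dec (b ≗ c)
  agrees c = all? λ j → b j ≟ᵇ c j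

allowedNeighbourhood-resp-≗ : ∀ {b c} → b ≗ c → AllowedNeighbourhood c → AllowedNeighbourhood b
allowedNeighbourhood-resp-≗ b≗c (inj₁ t)                   = inj₁ (λ j → trans (b≗c j) (t j))
allowedNeighbourhood-resp-≗ b≗c (inj₂ (inj₁ s))            = inj₂ (inj₁ (λ j → trans (b≗c j) (s j)))
allowedNeighbourhood-resp-≗ b≗c (inj₂ (inj₂ (i , inj₁ r))) = inj₂ (inj₂ (i , inj₁ (λ j → trans (b≗c j) (r j))))
allowedNeighbourhood-resp-≗ b≗c (inj₂ (inj₂ (i , inj₂ p))) = inj₂ (inj₂ (i , inj₂ (λ j → trans (b≗c j) (p j))))

ForbiddenNeighbourhood : (Fin 5 → Bool) → Set
ForbiddenNeighbourhood b = FullHom P5 A ⊎ FullHom TWheel A ⊎ FullHom YWheel A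
  where A = addVertex b C5

addEdge : (Fin 5 → Bool) → (Fin 5 → Bool) → Adjacency 7
addEdge bx by = addVertex (true ◂ by) (addVertex bx C5)

-- Abstract, so that uses of these facts never re-run the searches.
abstract
  neighbourhood-cases : ∀ (w : Vec Bool 5) →
                        AllowedNeighbourhood (lookup w) ⊎ ForbiddenNeighbourhood (lookup w)
  neighbourhood-cases = from-just (allBoolVecᵐ λ w →
    map inj₁ (dec⇒maybe (allowedNeighbourhood? (lookup w))) <∣>
    map inj₂ (map inj₁ (findFullHom P5 (A w)) <∣>
              map (inj₂ ∘ inj₁) (findFullHom TWheel (A w)) <∣>
              map (inj₂ ∘ inj₂) (findFullHom YWheel (A w))))
    where
    A : Vec Bool 5 → Adjacency 6
    A w = addVertex (lookup w) C5

  HVN-in-TP-edge : ∀ s t → FullHom HVN (addEdge (TP-pattern s) (TP-pattern t))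
  HVN-in-TP-edge = from-just (allMaybeᵐ λ s → allMaybeᵐ λ t →
    findFullHom HVN (addEdge (TP-pattern s) (TP-pattern t)))

  TWheel-in-R-edge : ∀ i → FullHom TWheel (addEdge (R-pattern i) (R-pattern i))
  TWheel-in-R-edge = from-just (allFinᵐ λ i → findFullHom TWheel (addEdge (R-pattern i) (R-pattern i)))

twinFree-P5 : TwinFree P5
twinFree-P5 = from-yes (twinFree? P5)

twinFree-HVN : TwinFree HVN
twinFree-HVN = from-yes (twinFree? HVN)

twinFree-TWheel : TwinFree TWheel
twinFree-TWheel = from-yes (twinFree? TWheel)

twinFree-YWheel : TwinFree YWheel
twinFree-YWheel = from-yes (twinFree? YWheel)

module _ {n} (G : Graph n) {v : Fin 5 → Fin n} (hC : IsFullHom C5 (adj G) v) where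

  neighbourhood-allowed : ¬ HasInduced G P5 → ¬ HasInduced G TWheel → ¬ HasInduced G YWheel →
                          ∀ u → AllowedNeighbourhood (adj G u ∘ v)
  neighbourhood-allowed noP5 noTWheel noYWheel u =
    [ allowedNeighbourhood-resp-≗ hb
    , ⊥-elim ∘ [ noP5 ∘ hasInduced G twinFree-P5 hu
               , [ noTWheel ∘ hasInduced G twinFree-TWheel hu
                 , noYWheel ∘ hasInduced G twinFree-YWheel hu ]′ ]′ ]′
    (neighbourhood-cases (tabulate (adj G u ∘ v)))
    where
    hb : adj G u ∘ v ≗ lookup (tabulate (adj G u ∘ v))
    hb = sym ∘ lookup∘tabulate (adj G u ∘ v)

    hu : IsFullHom (addVertex (lookup (tabulate (adj G u ∘ v))) C5) (adj G) (u ◂ v)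
    hu = isFullHom-addVertex G hC hb

  forbidden-edge⇒nonadjacent : ∀ {k} {H : Adjacency k} {bx by x y} →
                               ¬ HasInduced G H → TwinFree H → FullHom H (addEdge bx by) →
                               adj G x ∘ v ≗ bx → adj G y ∘ v ≗ by → adj G x y ≡ false
  forbidden-edge⇒nonadjacent {by = by} {x} {y} noH twinFree h hx hy with adj G x y in xy
  ... | false = refl
  ... | true  = ⊥-elim (noH (hasInduced G twinFree hxy h))
    where
    hy′ : adj G y ∘ (x ◂ v) ≗ (true ◂ by)
    hy′ zero    = trans (Graph.sym G y x) xy
    hy′ (suc j) = hy j

    hxy : IsFullHom (addEdge _ by) (adj G) (y ◂ (x ◂ v))
    hxy = isFullHom-addVertex G (isFullHom-addVertex G hC hx) hy′

  TPset⇒TP-pattern : ∀ {u} → TPset G v u → ∃ λ s → adj G u ∘ v ≗ TP-pattern s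
  TPset⇒TP-pattern (inj₁ t)       = nothing , t
  TPset⇒TP-pattern (inj₂ (i , p)) = just i , p

  TP-stable : ¬ HasInduced G HVN → Stable G (TPset G v)
  TP-stable noHVN x y x∈TP y∈TP with TPset⇒TP-pattern x∈TP | TPset⇒TP-pattern y∈TP
  ... | s , hx | t , hy = forbidden-edge⇒nonadjacent noHVN twinFree-HVN (HVN-in-TP-edge s t) hx hy

  R-stable : ¬ HasInduced G TWheel → ∀ i → Stable G (Rset G v i)
  R-stable noTWheel i x y hx hy =
    forbidden-edge⇒nonadjacent noTWheel twinFree-TWheel (TWheel-in-R-edge i) hx hy

lemma5p2 : ∀ {n : ℕ} (G : Graph n) → Connected G
         → ¬ HasInduced G P5 → ¬ HasInduced G HVN
         → ¬ HasInduced G TWheel → ¬ HasInduced G YWheel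
         → ∀ (C : HasInduced G C5)
         → let v = proj₁ C in
           (∀ (u : Fin n) → Tset G v u ⊎ Sset G v u ⊎ (∃ λ i → Rset G v i u ⊎ Pset G v i u))
           × Stable G (TPset G v)
           × (∀ (i : Fin 5) → Stable G (Rset G v i))
lemma5p2 G _ noP5 noHVN noTWheel noYWheel (_ , _ , hC) =
  neighbourhood-allowed G hC noP5 noTWheel noYWheel , TP-stable G hC noHVN , R-stable G hC noTWheel
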